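{- Let $G$ be an undirected unweighted graph, let $est(\cdot,\cdot)$ be values satisfying $est(x,y) \le 2|xy|+1$ for all vertex pairs $(x,y)$, and let $P$ be a shortest $s$–$t$ path. Then for each $i\in[0,\log\log n-1]$ for which $a_i,b_i$ exist, $est(u_i, v_i) \le 2|a_i b_i| + 5$.
   Context: $|xy|$ is the shortest-path distance. Given nested vertex sets $A_0\supseteq A_1\supseteq\dots\supseteq A_{\log\log n-1}$ with $A_0=V(G)$, $pivot_i(x)$ is a vertex of $A_i$ nearest to $x$. $a_i$ is the vertex of $P$ closest to $s$ such that $|a_i\,pivot_i(a_i)|\le1$, and $u_i:=pivot_i(a_i)$; $b_i$ is the vertex of $P$ closest to $t$ such that $|b_i\,pivot_i(b_i)|\le1$, and $v_i:=pivot_i(b_i)$. -}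

module Defs where

open import Data.Nat using (ℕ; zero; suc; _≤_; _<_)
open import Data.Nat.Logarithm using (⌈log₂_⌉)
open import Data.Fin using (Fin; toℕ; inject₁; fromℕ) renaming (zero to fzero; suc to fsuc)
open import Data.Fin.Subset using (Subset; _∈_; _⊆_; ⊤)
open import Data.Bool using (Bool; T)
open import Data.Product using (Σ; _×_; ∃)
open import Relation.Nullary using (¬_)
open import Relation.Binary.PropositionalEquality using (_≡_)

record Graph (n : ℕ) : Set where
  field
    adj   : Fin n → Fin n → Bool
    sym   : ∀ x y → adj x y ≡ adj y x
    irref : ∀ x → adj x x ≡ Data.Bool.false

module _ {n : ℕ} (G : Graph n) where
  open Graph G

  Edge : Fin n → Fin n → Set
  Edge x y = T (adj x y)

  data Walk : Fin n → Fin n → ℕ → Set where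
    nil  : ∀ {x} → Walk x x 0
    cons : ∀ {x y z k} → Edge x y → Walk y z k → Walk x z (suc k)

  -- |xy| = d : shortest-path distance (no such d if x,y are disconnected, i.e. |xy| = ∞)
  Dist : Fin n → Fin n → ℕ → Set
  Dist x y d = Walk x y d × (∀ k → Walk x y k → d ≤ k)

  DistAtMost : Fin n → Fin n → ℕ → Set
  DistAtMost x y m = Σ ℕ λ d → Dist x y d × d ≤ m

  record ShortestPath (s t : Fin n) : Set where
    field
      len   : ℕ
      vert  : Fin (suc len) → Fin n
      start : vert fzero ≡ s
      end   : vert (fromℕ len) ≡ t
      step  : ∀ (j : Fin len) → Edge (vert (inject₁ j)) (vert (fsuc j))
      short : Dist s t len

loglog : ℕ → ℕ
loglog n = ⌈log₂ ⌈log₂ n ⌉ ⌉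

module _ {n : ℕ} (G : Graph n) where

  record Hierarchy : Set where
    field
      A      : Fin (loglog n) → Subset n
      A0     : ∀ (i : Fin (loglog n)) → toℕ i ≡ 0 → A i ≡ ⊤
      nested : ∀ (i j : Fin (loglog n)) → toℕ i ≤ toℕ j → A j ⊆ A i

  IsPivot : (H : Hierarchy) → (Fin (loglog n) → Fin n → Fin n) → Set
  IsPivot H piv = ∀ i x → piv i x ∈ Hierarchy.A H i ×
    (∀ y → y ∈ Hierarchy.A H i → ∀ d' → Dist G x y d' → DistAtMost G x (piv i x) d')

  NearPivot : (Fin (loglog n) → Fin n → Fin n) → Fin (loglog n) → Fin n → Set
  NearPivot piv i x = DistAtMost G x (piv i x) 1

  module _ {s t : Fin n} (P : ShortestPath G s t) where
    open ShortestPath P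

    -- position j of a_i: first vertex of P (from s) with |a pivot_i(a)| ≤ 1
    IsFirstNear : (Fin (loglog n) → Fin n → Fin n) → Fin (loglog n) → Fin (suc len) → Set
    IsFirstNear piv i j = NearPivot piv i (vert j) ×
      (∀ j' → toℕ j' < toℕ j → ¬ NearPivot piv i (vert j'))

    -- position j of b_i: last vertex of P (closest to t) with |b pivot_i(b)| ≤ 1
    IsLastNear : (Fin (loglog n) → Fin n → Fin n) → Fin (loglog n) → Fin (suc len) → Set
    IsLastNear piv i j = NearPivot piv i (vert j) ×
      (∀ j' → toℕ j < toℕ j' → ¬ NearPivot piv i (vert j'))

{-# OPTIONS --safe #-}
-- u and v lie within distance 1 of a and b, so the triangle inequality gives
-- |uv| ≤ |ab| + 2 and the estimate gives est(u, v) ≤ 2(|ab| + 2) + 1.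
module Submission where

open import Defs
open import Data.Nat using (ℕ; zero; suc; _≤_; _+_; _*_; z≤n)
open import Data.Nat.Properties
  using (≤-refl; ≤-reflexive; ≤-trans; ≤-pred; m≤n⇒m≤1+n; m≤n⇒m<n∨m≡n; ≰⇒>; +-mono-≤; *-monoʳ-≤; +-monoˡ-≤)
open import Data.Nat.Tactic.RingSolver using (solve-∀)
open import Data.Fin using (Fin; _≟_)
open import Data.Fin.Properties using (any?)
open import Data.Product using (_×_; _,_; ∃)
open import Data.Bool using (T)
open import Data.Empty using (⊥)
open import Data.Sum using (inj₁; inj₂)
open import Relation.Nullary using (Dec; yes; no; contradiction)
open import Relation.Nullary.Decidable using (T?; _×-dec_)
open import Relation.Binary.PropositionalEquality using (_≡_; refl; subst)

module _ {n : ℕ} (G : Graph n) where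
  open Graph G using (adj)

  Edge-sym : ∀ {x y} → Edge G x y → Edge G y x
  Edge-sym {x} {y} = subst T (Graph.sym G x y)

  _++_ : ∀ {x y z k m} → Walk G x y k → Walk G y z m → Walk G x z (k + m)
  nil      ++ w′ = w′
  cons e w ++ w′ = cons e (w ++ w′)

  snoc : ∀ {x y z k} → Walk G x y k → Edge G y z → Walk G x z (suc k)
  snoc nil        e = cons e nil
  snoc (cons f w) e = cons f (snoc w e)

  reverse : ∀ {x y k} → Walk G x y k → Walk G y x k
  reverse nil        = nil
  reverse (cons e w) = snoc (reverse w) (Edge-sym e)

  walk? : ∀ x y k → Dec (Walk G x y k)
  walk? x y zero with x ≟ y
  ... | yes refl = yes nil
  ... | no x≢y   = no λ { nil → x≢y refl }
  walk? x y (suc k) with any? (λ z → T? (adj x z) ×-dec walk? z y k)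
  ... | yes (z , e , w) = yes (cons e w)
  ... | no ∄step        = no λ { (cons e w) → ∄step (_ , e , w) }

  WalkWithin : Fin n → Fin n → ℕ → Set
  WalkWithin x y m = ∃ λ k → k ≤ m × Walk G x y k

  walkWithin? : ∀ x y m → Dec (WalkWithin x y m)
  walkWithin? x y zero with walk? x y zero
  ... | yes w = yes (zero , z≤n , w)
  ... | no ∄w = no λ { (zero , z≤n , w) → ∄w w }
  walkWithin? x y (suc m) with walk? x y (suc m) | walkWithin? x y m
  ... | yes w | _                = yes (suc m , ≤-refl , w)
  ... | no _  | yes (k , k≤m , w) = yes (k , m≤n⇒m≤1+n k≤m , w)
  ... | no ∄w | no ∄shorter      = no λ (k , k≤1+m , w) → no-walk k≤1+m w
    where
    no-walk : ∀ {k} → k ≤ suc m → Walk G x y k → ⊥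
    no-walk k≤1+m w with m≤n⇒m<n∨m≡n k≤1+m
    ... | inj₁ k<1+m = ∄shorter (_ , ≤-pred k<1+m , w)
    ... | inj₂ refl  = ∄w w

  -- A least length exists because the lengths below any given bound can be searched.
  walkWithin⇒distAtMost : ∀ {x y} m → WalkWithin x y m → DistAtMost G x y m
  walkWithin⇒distAtMost zero (zero , z≤n , w) = zero , (w , λ _ _ → z≤n) , z≤n
  walkWithin⇒distAtMost {x} {y} (suc m) (k , k≤1+m , w) with walkWithin? x y m
  ... | yes shorter with walkWithin⇒distAtMost m shorter
  ...   | d , D , d≤m = d , D , m≤n⇒m≤1+n d≤m
  walkWithin⇒distAtMost (suc m) (k , k≤1+m , w) | no ∄shorter with m≤n⇒m<n∨m≡n k≤1+m
  ... | inj₁ k<1+m = contradiction (_ , ≤-pred k<1+m , w) ∄shorter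
  ... | inj₂ refl  =
    suc m , (w , λ k′ w′ → ≰⇒> λ k′≤m → ∄shorter (k′ , k′≤m , w′)) , ≤-refl

  walk⇒distAtMost : ∀ {x y k} → Walk G x y k → DistAtMost G x y k
  walk⇒distAtMost w = walkWithin⇒distAtMost _ (_ , ≤-refl , w)

  dist⇒distAtMost : ∀ {x y d} → Dist G x y d → DistAtMost G x y d
  dist⇒distAtMost D = _ , D , ≤-refl

  distAtMost-sym : ∀ {x y m} → DistAtMost G x y m → DistAtMost G y x m
  distAtMost-sym (d , (w , _) , d≤m) with walk⇒distAtMost (reverse w)
  ... | d′ , D′ , d′≤d = d′ , D′ , ≤-trans d′≤d d≤m

  distAtMost-trans : ∀ {x y z m m′} →
    DistAtMost G x y m → DistAtMost G y z m′ → DistAtMost G x z (m + m′)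
  distAtMost-trans (d , (w , _) , d≤m) (d′ , (w′ , _) , d′≤m′) with walk⇒distAtMost (w ++ w′)
  ... | e , E , e≤d+d′ = e , E , ≤-trans e≤d+d′ (+-mono-≤ d≤m d′≤m′)

  est-distAtMost : (est : Fin n → Fin n → ℕ) → (∀ x y d → Dist G x y d → est x y ≤ 2 * d + 1) →
    ∀ {x y m} → DistAtMost G x y m → est x y ≤ 2 * m + 1
  est-distAtMost est est≤ (d , D , d≤m) = ≤-trans (est≤ _ _ d D) (+-monoˡ-≤ 1 (*-monoʳ-≤ 2 d≤m))

lemma10 : ∀ {n : ℕ} (G : Graph n) (est : Fin n → Fin n → ℕ)
    → (∀ x y d → Dist G x y d → est x y ≤ 2 * d + 1)
    → (H : Hierarchy G) (piv : Fin (loglog n) → Fin n → Fin n) → IsPivot G H piv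
    → ∀ {s t : Fin n} (P : ShortestPath G s t) (i : Fin (loglog n))
    → ∀ ja jb → IsFirstNear G P piv i ja → IsLastNear G P piv i jb
    → ∀ d → Dist G (ShortestPath.vert P ja) (ShortestPath.vert P jb) d
    → est (piv i (ShortestPath.vert P ja)) (piv i (ShortestPath.vert P jb)) ≤ 2 * d + 5
lemma10 G est est≤ _ piv _ P i ja jb (a~u , _) (b~v , _) d ab =
  ≤-trans (est-distAtMost G est est≤ u~v) (≤-reflexive (arithmetic d))
  where
  open ShortestPath P using (vert)
  u~v : DistAtMost G (piv i (vert ja)) (piv i (vert jb)) (1 + (d + 1))
  u~v = distAtMost-trans G (distAtMost-sym G a~u) (distAtMost-trans G (dist⇒distAtMost G ab) b~v)
  arithmetic : ∀ d → 2 * (1 + (d + 1)) + 1 ≡ 2 * d + 5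
  arithmetic = solve-∀
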